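{- Let $G$ and $H$ be two nontrivial connected graphs. Then $$\max\{hn_{cc}(G),hn_{cc}(H),3\}\le hn_{cc}(G\Box H)\le hn_{cc}(G)+hn_{cc}(H)-1.$$
   Context: All graphs are finite, simple and undirected. Cycle convexity on a graph $G$: for $S\subseteq V(G)$, the cycle interval $\langle S\rangle$ is $S$ together with every vertex $w\in V(G)$ that lies on a cycle of the induced subgraph $G[S\cup\{w\}]$ passing through $w$. $S$ is (cycle) convex if $\langle S\rangle=S$. The cycle convex hull $\langle S\rangle_C$ is the smallest convex set containing $S$. $S$ is a hull set if $\langle S\rangle_C=V(G)$, and $hn_{cc}(G)$ is the minimum cardinality of a hull set of $G$. The Cartesian product $G\Box H$ has vertex set $V(G)\times V(H)$, with $(g_1,h_1)\sim(g_2,h_2)$ iff ($g_1\sim g_2$ and $h_1=h_2$) or ($g_1=g_2$ and $h_1\sim h_2$). A graph is nontrivial if it has at least two vertices. -}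

module Defs where

open import Data.Nat using (ℕ; _≤_; _+_; _*_; _⊔_)
open import Data.Fin using (Fin; remQuot)
open import Data.Fin.Properties using (_≟_)
open import Data.Fin.Subset using (Subset; _∈_; _⊆_; ∣_∣)
open import Data.List using (List; _∷_; _∷ʳ_; length)
open import Data.List.Relation.Unary.All using (All)
open import Data.List.Relation.Unary.Linked using (Linked)
open import Data.List.Relation.Unary.Unique.Propositional using (Unique)
open import Data.Product using (Σ; ∃; _×_; _,_; proj₁; proj₂)
open import Data.Sum using (_⊎_; inj₁; inj₂)
open import Data.Empty using (⊥)
open import Relation.Nullary using (Dec; ¬_)
open import Relation.Nullary.Decidable using (_×-dec_; _⊎-dec_)
open import Relation.Binary.PropositionalEquality using (_≡_; refl; sym)
open import Relation.Binary.Construct.Closure.ReflexiveTransitive using (Star)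

record Graph : Set₁ where
  field
    size   : ℕ
    Adj    : Fin size → Fin size → Set
    adj?   : ∀ u v → Dec (Adj u v)
    adj-sym : ∀ {u v} → Adj u v → Adj v u
    adj-irrefl : ∀ {u} → ¬ Adj u u
open Graph public

Nontrivial : Graph → Set
Nontrivial G = 2 ≤ size G

Connected : Graph → Set
Connected G = ∀ u v → Star (Adj G) u v

-- w lies on a cycle of G[S ∪ {w}] passing through w:
-- there are distinct vertices u₁ … u_k (k ≥ 2), all in S and distinct from w,
-- such that w u₁ … u_k w is a closed walk.
OnCycle : (G : Graph) → Subset (size G) → Fin (size G) → Set
OnCycle G S w =
  Σ (List (Fin (size G))) λ us →
    (2 ≤ length us) × All (_∈ S) us × Unique (w ∷ us) × Linked (Adj G) ((w ∷ us) ∷ʳ w)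

InInterval : (G : Graph) → Subset (size G) → Fin (size G) → Set
InInterval G S w = w ∈ S ⊎ OnCycle G S w

Convex : (G : Graph) → Subset (size G) → Set
Convex G S = ∀ w → InInterval G S w → w ∈ S

-- membership in the cycle convex hull ⟨S⟩_C: the smallest convex set
-- containing S, i.e. the intersection of all convex supersets of S
InHull : (G : Graph) → Subset (size G) → Fin (size G) → Set
InHull G S v = ∀ (T : Subset (size G)) → S ⊆ T → Convex G T → v ∈ T

IsHullSet : (G : Graph) → Subset (size G) → Set
IsHullSet G S = ∀ v → InHull G S v

IsHullNumber : Graph → ℕ → Set
IsHullNumber G k =
  (Σ (Subset (size G)) λ S → IsHullSet G S × ∣ S ∣ ≡ k)
  × (∀ S → IsHullSet G S → k ≤ ∣ S ∣)

-- Cartesian product G □ H, vertex set Fin (|G| * |H|) ≅ Fin |G| × Fin |H| via remQuot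
private
  ProdAdj : (G H : Graph) → Fin (size G) × Fin (size H) → Fin (size G) × Fin (size H) → Set
  ProdAdj G H (g₁ , h₁) (g₂ , h₂) = (Adj G g₁ g₂ × h₁ ≡ h₂) ⊎ (g₁ ≡ g₂ × Adj H h₁ h₂)

  prodAdj? : (G H : Graph) → ∀ x y → Dec (ProdAdj G H x y)
  prodAdj? G H (g₁ , h₁) (g₂ , h₂) =
    (adj? G g₁ g₂ ×-dec (h₁ ≟ h₂)) ⊎-dec ((g₁ ≟ g₂) ×-dec adj? H h₁ h₂)

  prodSym : (G H : Graph) → ∀ {x y} → ProdAdj G H x y → ProdAdj G H y x
  prodSym G H (inj₁ (a , e)) = inj₁ (adj-sym G a , sym e)
  prodSym G H (inj₂ (e , a)) = inj₂ (sym e , adj-sym H a)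

  prodIrr : (G H : Graph) → ∀ {x} → ¬ ProdAdj G H x x
  prodIrr G H (inj₁ (a , _)) = adj-irrefl G a
  prodIrr G H (inj₂ (_ , a)) = adj-irrefl H a

_□_ : Graph → Graph → Graph
G □ H = record
  { size   = size G * size H
  ; Adj    = λ x y → ProdAdj G H (rq x) (rq y)
  ; adj?   = λ x y → prodAdj? G H (rq x) (rq y)
  ; adj-sym = prodSym G H
  ; adj-irrefl = prodIrr G H
  }
  where
  rq : Fin (size G * size H) → Fin (size G) × Fin (size H)
  rq = remQuot {size G} (size H)

-- Projections G □ H → G, H and layer embeddings G, H → G □ H pull convex sets back to
-- convex sets, because a cycle through w whose other vertices avoid the fibre of the image
-- of w maps to a cycle through that image. Hence a hull set of G □ H projects onto hull sets
-- of G and H. Conversely, a hull set of G placed in the layer G × {h₀}, together with a hull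
-- set of H minus h₀ placed in {g₀} × H, generates both layers, and along edges of G and H a
-- convex set spreads from these two layers to all of G □ H, since it contains the fourth
-- corner of every 4-cycle (g,h) (g′,h) (g,h′) (g′,h′) of which it contains three. Finally,
-- layers are convex, and so is a pair of vertices differing in both coordinates, which misses
-- its corner; so a hull set needs a third vertex.
module Submission where

open import Defs
open import Data.Nat using (ℕ; _≤_; _<_; _+_; _∸_; _⊔_; pred; z≤n; s≤s)
open import Data.Nat.Properties
  using (≤-trans; ≤-reflexive; +-suc; +-monoʳ-≤; +-mono-≤; +-∸-assoc; <⇒≤pred; ⊔-lub; module ≤-Reasoning)
open import Data.Fin using (Fin; zero; suc; punchIn; combine; remQuot)
open import Data.Fin.Properties using (_≟_; any?; punchInᵢ≢i; remQuot-combine; combine-remQuot; combine-injective)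
open import Data.Fin.Subset using (Subset; _∈_; _∉_; _⊆_; ∣_∣; ⁅_⁆; _∪_; _-_; inside; outside; Nonempty)
  renaming (⊥ to ∅)
open import Data.Fin.Subset.Properties
  using (_∈?_; x∈⁅x⁆; x∈⁅y⁆⇒x≡y; x∈p∪q⁻; x∈p∪q⁺; ∣p∣≤∣x∷p∣; ∉⊥; ∣⊥∣≡0; ∣⁅x⁆∣≡1;
         x∈p∧x≢y⇒x∈p-y; x∈p⇒∣p-x∣<∣p∣)
open import Data.List using (List; []; _∷_; _++_; [_]; length)
open import Data.List.Membership.Propositional using () renaming (_∈_ to _∈ₗ_)
open import Data.List.Relation.Unary.All as All using (All; []; _∷_)
open import Data.List.Relation.Unary.All.Properties using (¬Any⇒All¬)
open import Data.List.Relation.Unary.Any as Any using (here; there)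
open import Data.List.Relation.Unary.AllPairs using ([]; _∷_)
open import Data.List.Relation.Unary.Linked using (Linked; [-]; _∷_)
open import Data.List.Relation.Unary.Unique.Propositional using (Unique)
open import Data.Product using (∃; _×_; _,_; proj₁; proj₂)
open import Data.Sum using (_⊎_; inj₁; inj₂)
open import Data.Vec using (_∷_; []; tabulate; here; there)
open import Data.Vec.Properties using (lookup⇒[]=; []=⇒lookup; lookup∘tabulate)
open import Function using (_∘_; id)
open import Function.Definitions using (Injective)
open import Relation.Binary.Construct.Closure.ReflexiveTransitive using (Star; foldl)
open import Relation.Binary.PropositionalEquality
  using (_≡_; _≢_; refl; sym; trans; cong; cong₂; subst; subst₂; ≢-sym; module ≡-Reasoning)
open import Relation.Nullary using (¬_; yes; no; does; contradiction; ¬?)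
open import Relation.Nullary.Decidable using (_×-dec_; decidable-stable; dec-true)

propagate : ∀ {A : Set} {R : A → A → Set} (P : A → Set) →
            (∀ {x y} → R x y → P x → P y) → ∀ {x y} → Star R x y → P x → P y
propagate P step = foldl (λ x y → P x → P y) (λ f r → step r ∘ f) id

some-element : ∀ {n} → 2 ≤ n → Fin n
some-element (s≤s _) = zero

another-element : ∀ {n} → 2 ≤ n → (i : Fin n) → ∃ λ j → j ≢ i
another-element (s≤s (s≤s _)) i = punchIn i zero , punchInᵢ≢i i zero

_⁻¹_ : ∀ {n m} → (Fin n → Fin m) → Subset m → Subset n
f ⁻¹ T = tabulate (λ x → does (f x ∈? T))

module _ {n m} (f : Fin n → Fin m) {T : Subset m} where

  ∈-preimage⁺ : ∀ {x} → f x ∈ T → x ∈ f ⁻¹ T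
  ∈-preimage⁺ {x} fx∈T = lookup⇒[]= x _ (trans (lookup∘tabulate _ x) (dec-true (f x ∈? T) fx∈T))

  ∈-preimage⁻ : ∀ {x} → x ∈ f ⁻¹ T → f x ∈ T
  ∈-preimage⁻ {x} x∈f⁻¹T with f x ∈? T | trans (sym (lookup∘tabulate _ x)) ([]=⇒lookup x∈f⁻¹T)
  ... | yes fx∈T | _ = fx∈T
  ... | no _     | ()

image : ∀ {n m} → (Fin n → Fin m) → Subset n → Subset m
image f []            = ∅
image f (inside ∷ p)  = ⁅ f zero ⁆ ∪ image (f ∘ suc) p
image f (outside ∷ p) = image (f ∘ suc) p

∈-image⁺ : ∀ {n m} (f : Fin n → Fin m) {p x} → x ∈ p → f x ∈ image f p
∈-image⁺ f {inside ∷ p} here        = x∈p∪q⁺ (inj₁ (x∈⁅x⁆ (f zero)))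
∈-image⁺ f {inside ∷ p} (there x∈p) = x∈p∪q⁺ (inj₂ (∈-image⁺ (f ∘ suc) x∈p))
∈-image⁺ f {outside ∷ p} (there x∈p) = ∈-image⁺ (f ∘ suc) x∈p

∣p∪q∣≤∣p∣+∣q∣ : ∀ {n} (p q : Subset n) → ∣ p ∪ q ∣ ≤ ∣ p ∣ + ∣ q ∣
∣p∪q∣≤∣p∣+∣q∣ []            []            = z≤n
∣p∪q∣≤∣p∣+∣q∣ (inside ∷ p)  (s ∷ q)       = s≤s (≤-trans (∣p∪q∣≤∣p∣+∣q∣ p q) (+-monoʳ-≤ ∣ p ∣ (∣p∣≤∣x∷p∣ s q)))
∣p∪q∣≤∣p∣+∣q∣ (outside ∷ p) (inside ∷ q)  = ≤-trans (s≤s (∣p∪q∣≤∣p∣+∣q∣ p q)) (≤-reflexive (sym (+-suc ∣ p ∣ ∣ q ∣)))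
∣p∪q∣≤∣p∣+∣q∣ (outside ∷ p) (outside ∷ q) = ∣p∪q∣≤∣p∣+∣q∣ p q

∣image∣≤∣p∣ : ∀ {n m} (f : Fin n → Fin m) (p : Subset n) → ∣ image f p ∣ ≤ ∣ p ∣
∣image∣≤∣p∣ {m = m} f []  = ≤-reflexive (∣⊥∣≡0 m)
∣image∣≤∣p∣ f (inside ∷ p) = begin
  ∣ ⁅ f zero ⁆ ∪ image (f ∘ suc) p ∣     ≤⟨ ∣p∪q∣≤∣p∣+∣q∣ ⁅ f zero ⁆ _ ⟩
  ∣ ⁅ f zero ⁆ ∣ + ∣ image (f ∘ suc) p ∣ ≡⟨ cong (_+ ∣ image (f ∘ suc) p ∣) (∣⁅x⁆∣≡1 (f zero)) ⟩
  1 + ∣ image (f ∘ suc) p ∣              ≤⟨ s≤s (∣image∣≤∣p∣ (f ∘ suc) p) ⟩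
  1 + ∣ p ∣                              ∎
  where open ≤-Reasoning
∣image∣≤∣p∣ f (outside ∷ p) = ∣image∣≤∣p∣ (f ∘ suc) p

∈⁅x⁆∪⁅y⁆⁻ : ∀ {n} {v} (x y : Fin n) → v ∈ ⁅ x ⁆ ∪ ⁅ y ⁆ → v ≡ x ⊎ v ≡ y
∈⁅x⁆∪⁅y⁆⁻ x y v∈ with x∈p∪q⁻ ⁅ x ⁆ ⁅ y ⁆ v∈
... | inj₁ v∈⁅x⁆ = inj₁ (x∈⁅y⁆⇒x≡y x v∈⁅x⁆)
... | inj₂ v∈⁅y⁆ = inj₂ (x∈⁅y⁆⇒x≡y y v∈⁅y⁆)

length≤∣p∣ : ∀ {n} {p : Subset n} {xs} → Unique xs → All (_∈ p) xs → length xs ≤ ∣ p ∣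
length≤∣p∣ []                [] = z≤n
length≤∣p∣ (x≢xs ∷ unique) (x∈p ∷ xs⊆p) =
  ≤-trans (s≤s (length≤∣p∣ unique (All.zipWith (λ (y∈p , x≢y) → x∈p∧x≢y⇒x∈p-y y∈p (≢-sym x≢y)) (xs⊆p , x≢xs))))
          (x∈p⇒∣p-x∣<∣p∣ x∈p)

Vertex : Graph → Set
Vertex G = Fin (size G)

infixr 5 _◅_

data Walk (G : Graph) : Vertex G → Vertex G → List (Vertex G) → Set where
  ε   : ∀ {a} → Walk G a a []
  _◅_ : ∀ {a x b xs} → Adj G a x → Walk G x b xs → Walk G a b (x ∷ xs)

module _ {G : Graph} where

  end-∈ : ∀ {a b xs} → Walk G a b xs → b ∈ₗ a ∷ xs
  end-∈ ε       = here refl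
  end-∈ (_ ◅ w) = there (end-∈ w)

  walk-from-linked : ∀ a xs {c} → Linked (Adj G) (a ∷ xs ++ [ c ]) →
                     ∃ λ b → Walk G a b xs × Adj G b c
  walk-from-linked a []       (a~c ∷ [-]) = a , ε , a~c
  walk-from-linked a (x ∷ xs) (a~x ∷ linked) with b , w , b~c ← walk-from-linked x xs linked =
    b , a~x ◅ w , b~c

  linked-from-walk : ∀ {a b c xs} → Walk G a b xs → Adj G b c → Linked (Adj G) (a ∷ xs ++ [ c ])
  linked-from-walk ε         b~c = b~c ∷ [-]
  linked-from-walk (a~x ◅ w) b~c = a~x ∷ linked-from-walk w b~c

  module _ {P : Vertex G → Set} where

    drop-until : ∀ {a x b xs} → a ∈ₗ x ∷ xs → Walk G x b xs → All P xs → Unique (x ∷ xs) →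
                 ∃ λ ys → Walk G a b ys × All P ys × Unique (a ∷ ys)
    drop-until (here refl) w         ps       unique       = _ , w , ps , unique
    drop-until (there ())  ε         _        _
    drop-until (there a∈)  (_ ◅ w)   (_ ∷ ps) (_ ∷ unique) = drop-until a∈ w ps unique

    erase-loops : ∀ {a b xs} → Walk G a b xs → All P xs →
                  ∃ λ ys → Walk G a b ys × All P ys × Unique (a ∷ ys)
    erase-loops ε [] = [] , ε , [] , [] ∷ []
    erase-loops {a} (a~x ◅ w) (px ∷ ps) with erase-loops w ps
    ... | ys , path , ps′ , unique with Any.any? (a ≟_) (_ ∷ ys)
    ...   | yes a∈ = drop-until a∈ path ps′ unique
    ...   | no a∉  = _ ∷ ys , a~x ◅ path , px ∷ ps′ , ¬Any⇒All¬ _ a∉ ∷ unique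

-- The cycle w u₁ … uₖ w of OnCycle, cut open at w: a walk from u₁ to uₖ ≢ u₁ inside S.
record Detour (G : Graph) (S : Subset (size G)) (w : Vertex G) : Set where
  field
    {first last} : Vertex G
    {inner}      : List (Vertex G)
    walk         : Walk G first last inner
    first≢last   : first ≢ last
    inside-S     : All (_∈ S) (first ∷ inner)
    enter        : Adj G w first
    leave        : Adj G last w

  last∈S : last ∈ S
  last∈S = All.lookup inside-S (end-∈ walk)

module _ {G : Graph} {S : Subset (size G)} {w : Vertex G} where

  onCycle⇒detour : OnCycle G S w → Detour G S w
  onCycle⇒detour ([] , () , _)
  onCycle⇒detour (_ ∷ [] , s≤s () , _)
  onCycle⇒detour (u ∷ x ∷ xs , _ , inside-S , _ ∷ (u≢xs ∷ _) , w~u ∷ linked)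
    with b , u~x ◅ walk , b~w ← walk-from-linked u (x ∷ xs) linked = record
    { walk       = u~x ◅ walk
    ; first≢last = All.lookup u≢xs (end-∈ walk)
    ; inside-S   = inside-S
    ; enter      = w~u
    ; leave      = b~w
    }

  detour⇒onCycle : w ∉ S → Detour G S w → OnCycle G S w
  detour⇒onCycle w∉S d = close (erase-loops walk (All.tail inside-S))
    where
    open Detour d
    first∈S : first ∈ S
    first∈S = All.head inside-S
    w≢ : ∀ {v} → v ∈ S → w ≢ v
    w≢ v∈S refl = w∉S v∈S
    close : (∃ λ ys → Walk G first last ys × All (_∈ S) ys × Unique (first ∷ ys)) → OnCycle G S w
    close ([] , ε , _) = contradiction refl first≢last
    close (ys@(_ ∷ _) , path , ys⊆S , unique) =
      first ∷ ys , s≤s (s≤s z≤n) , first∈S ∷ ys⊆S ,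
      All.map w≢ (first∈S ∷ ys⊆S) ∷ unique , enter ∷ linked-from-walk path leave

module _ {G : Graph} {T : Subset (size G)} where

  detour-closed⇒convex : (∀ {w} → Detour G T w → w ∈ T) → Convex G T
  detour-closed⇒convex closed w (inj₁ w∈T)  = w∈T
  detour-closed⇒convex closed w (inj₂ cycle) = closed (onCycle⇒detour cycle)

  convex⇒detour-closed : Convex G T → ∀ {w} → (w ∉ T → Detour G T w) → w ∈ T
  convex⇒detour-closed convex {w} detour with w ∈? T
  ... | yes w∈T = w∈T
  ... | no  w∉T = convex w (inj₂ (detour⇒onCycle w∉T (detour w∉T)))

  independent⇒convex : (∀ {x y} → x ∈ T → y ∈ T → ¬ Adj G x y) → Convex G T
  independent⇒convex independent = detour-closed⇒convex closed
    where
    closed : ∀ {w} → Detour G T w → w ∈ T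
    closed record { walk = ε ; first≢last = first≢last } = contradiction refl first≢last
    closed record { walk = x~y ◅ _ ; inside-S = x∈T ∷ y∈T ∷ _ } = contradiction x~y (independent x∈T y∈T)

  hullSet-escapes : ∀ {S v} → IsHullSet G S → Convex G T → v ∉ T → ∃ λ x → x ∈ S × x ∉ T
  hullSet-escapes {S} {v} hull convex v∉T with any? (λ x → x ∈? S ×-dec ¬? (x ∈? T))
  ... | yes escape = escape
  ... | no  none   = contradiction (hull v T S⊆T convex) v∉T
    where
    S⊆T : S ⊆ T
    S⊆T {x} x∈S = decidable-stable (x ∈? T) (λ x∉T → none (x , x∈S , x∉T))

module _ {G : Graph} where

  ∅-convex : Convex G ∅
  ∅-convex = independent⇒convex {G = G} (λ x∈∅ _ → contradiction x∈∅ ∉⊥)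

  ⁅⁆-convex : ∀ v → Convex G ⁅ v ⁆
  ⁅⁆-convex v = independent⇒convex {G = G} λ x∈⁅v⁆ y∈⁅v⁆ →
    irreflexive (x∈⁅y⁆⇒x≡y v x∈⁅v⁆) (x∈⁅y⁆⇒x≡y v y∈⁅v⁆)
    where
    irreflexive : ∀ {x y} → x ≡ v → y ≡ v → ¬ Adj G x y
    irreflexive refl refl = adj-irrefl G

  hullSet-nonempty : ∀ {S} → IsHullSet G S → Vertex G → Nonempty S
  hullSet-nonempty hull v with x , x∈S , _ ← hullSet-escapes {G = G} {v = v} hull ∅-convex ∉⊥ = x , x∈S

-- Weak homomorphisms that are injective on the neighbours of w outside the fibre of w:
-- exactly what is needed to map a detour of w to a detour of its image.
record CycleProjection (K G : Graph) : Set where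
  field
    map                 : Vertex K → Vertex G
    edge⇒≡⊎edge         : ∀ {x y} → Adj K x y → map x ≡ map y ⊎ Adj G (map x) (map y)
    injective-off-fibre : ∀ {w u u′} → Adj K w u → Adj K w u′ → map w ≢ map u → map u ≡ map u′ → u ≡ u′

embedding : ∀ {G K} (f : Vertex G → Vertex K) → Injective _≡_ _≡_ f →
            (∀ {x y} → Adj G x y → Adj K (f x) (f y)) → CycleProjection G K
embedding f injective homomorphism = record
  { map                 = f
  ; edge⇒≡⊎edge         = inj₂ ∘ homomorphism
  ; injective-off-fibre = λ _ _ _ → injective
  }

module _ {K G : Graph} (f : CycleProjection K G) where
  open CycleProjection f

  edge⇒edge : ∀ {x y} → map x ≢ map y → Adj K x y → Adj G (map x) (map y)
  edge⇒edge fx≢fy x~y with edge⇒≡⊎edge x~y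
  ... | inj₁ fx≡fy = contradiction fx≡fy fx≢fy
  ... | inj₂ fx~fy = fx~fy

  map-walk : ∀ {P : Vertex G → Set} {a b xs} → Walk K a b xs → All (P ∘ map) xs →
             ∃ λ ys → Walk G (map a) (map b) ys × All P ys
  map-walk ε [] = [] , ε , []
  map-walk {P} {b = b} (a~x ◅ w) (px ∷ ps) with ys , w′ , ps′ ← map-walk {P} w ps | edge⇒≡⊎edge a~x
  ... | inj₁ fa≡fx = ys , subst (λ v → Walk G v (map b) ys) (sym fa≡fx) w′ , ps′
  ... | inj₂ fa~fx = _ ∷ ys , fa~fx ◅ w′ , px ∷ ps′

  map-detour : ∀ {T w} → map w ∉ T → Detour K (map ⁻¹ T) w → Detour G T (map w)
  map-detour {T} {w} fw∉T d = detour (map-walk {_∈ T} walk (All.map (∈-preimage⁻ map) (All.tail inside-S)))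
    where
    open Detour d
    fw≢ : ∀ {x} → map x ∈ T → map w ≢ map x
    fw≢ fx∈T fw≡fx = fw∉T (subst (_∈ T) (sym fw≡fx) fx∈T)
    ffirst∈T : map first ∈ T
    ffirst∈T = ∈-preimage⁻ map (All.head inside-S)
    fw≢ffirst : map w ≢ map first
    fw≢ffirst = fw≢ ffirst∈T
    detour : (∃ λ ys → Walk G (map first) (map last) ys × All (_∈ T) ys) → Detour G T (map w)
    detour (_ , path , ys⊆T) = record
      { walk       = path
      ; first≢last = first≢last ∘ injective-off-fibre enter (adj-sym K leave) fw≢ffirst
      ; inside-S   = ffirst∈T ∷ ys⊆T
      ; enter      = edge⇒edge fw≢ffirst enter
      ; leave      = edge⇒edge (fw≢ (∈-preimage⁻ map last∈S) ∘ sym) leave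
      }

  convex-preimage : ∀ {T} → Convex G T → Convex K (map ⁻¹ T)
  convex-preimage convex = detour-closed⇒convex λ d →
    ∈-preimage⁺ map (convex⇒detour-closed convex (λ fw∉T → map-detour fw∉T d))

  hullSet-maps-into-convex : ∀ {S T} → IsHullSet K S → Convex G T →
                             (∀ {x} → x ∈ S → map x ∈ T) → ∀ x → map x ∈ T
  hullSet-maps-into-convex {T = T} hull convex S→T x =
    ∈-preimage⁻ map (hull x (map ⁻¹ T) (∈-preimage⁺ map ∘ S→T) (convex-preimage convex))

  module _ (section : Vertex G → Vertex K) (map∘section : ∀ v → map (section v) ≡ v) where

    image-hullSet : ∀ {S} → IsHullSet K S → IsHullSet G (image map S)
    image-hullSet hull v T S⊆T convex =
      subst (_∈ T) (map∘section v) (hullSet-maps-into-convex hull convex (S⊆T ∘ ∈-image⁺ map) (section v))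

    hullNumber-≤ : ∀ {a c} → IsHullNumber G a → IsHullNumber K c → a ≤ c
    hullNumber-≤ (_ , minimal) ((S , hull , refl) , _) =
      ≤-trans (minimal (image map S) (image-hullSet hull)) (∣image∣≤∣p∣ map S)

    hullSet-leaves-fibre : Nontrivial G → ∀ {S} → IsHullSet K S → ∀ x → ∃ λ y → y ∈ S × map y ≢ map x
    hullSet-leaves-fibre nontrivial {S} hull x =
      leave (hullSet-escapes {K} hull (convex-preimage (⁅⁆-convex {G} (map x))) section-v∉fibre)
      where
      fibre : Subset (size K)
      fibre = map ⁻¹ ⁅ map x ⁆
      v : Vertex G
      v = proj₁ (another-element nontrivial (map x))
      section-v∉fibre : section v ∉ fibre
      section-v∉fibre v∈ = proj₂ (another-element nontrivial (map x))
        (trans (sym (map∘section v)) (x∈⁅y⁆⇒x≡y (map x) (∈-preimage⁻ map v∈)))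
      leave : (∃ λ y → y ∈ S × y ∉ fibre) → ∃ λ y → y ∈ S × map y ≢ map x
      leave (y , y∈S , y∉fibre) =
        y , y∈S , λ fy≡fx → y∉fibre (∈-preimage⁺ map (subst (_∈ ⁅ map x ⁆) (sym fy≡fx) (x∈⁅x⁆ (map x))))

module Product (G H : Graph) where

  π₁ : Vertex (G □ H) → Vertex G
  π₁ v = proj₁ (remQuot {size G} (size H) v)

  π₂ : Vertex (G □ H) → Vertex H
  π₂ v = proj₂ (remQuot {size G} (size H) v)

  ⟨_,_⟩ : Vertex G → Vertex H → Vertex (G □ H)
  ⟨_,_⟩ = combine

  π₁-⟨,⟩ : ∀ g h → π₁ ⟨ g , h ⟩ ≡ g
  π₁-⟨,⟩ g h = cong proj₁ (remQuot-combine {size G} {size H} g h)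

  π₂-⟨,⟩ : ∀ g h → π₂ ⟨ g , h ⟩ ≡ h
  π₂-⟨,⟩ g h = cong proj₂ (remQuot-combine {size G} {size H} g h)

  ⟨π₁,π₂⟩ : ∀ v → ⟨ π₁ v , π₂ v ⟩ ≡ v
  ⟨π₁,π₂⟩ = combine-remQuot {size G} (size H)

  π-injective : ∀ {x y} → π₁ x ≡ π₁ y → π₂ x ≡ π₂ y → x ≡ y
  π-injective {x} {y} π₁x≡π₁y π₂x≡π₂y = begin
    x                 ≡⟨ ⟨π₁,π₂⟩ x ⟨
    ⟨ π₁ x , π₂ x ⟩   ≡⟨ cong₂ ⟨_,_⟩ π₁x≡π₁y π₂x≡π₂y ⟩
    ⟨ π₁ y , π₂ y ⟩   ≡⟨ ⟨π₁,π₂⟩ y ⟩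
    y                 ∎
    where open ≡-Reasoning

  -- Adj (G □ H) x y unfolds to Step (remQuot x) (remQuot y).
  Step : Vertex G × Vertex H → Vertex G × Vertex H → Set
  Step (g , h) (g′ , h′) = (Adj G g g′ × h ≡ h′) ⊎ (g ≡ g′ × Adj H h h′)

  step⇒edge : ∀ {g h g′ h′} → Step (g , h) (g′ , h′) → Adj (G □ H) ⟨ g , h ⟩ ⟨ g′ , h′ ⟩
  step⇒edge {g} {h} {g′} {h′} = subst₂ Step (sym (remQuot-combine {size G} {size H} g h)) (sym (remQuot-combine g′ h′))

  row-edge : ∀ {g g′ h} → Adj G g g′ → Adj (G □ H) ⟨ g , h ⟩ ⟨ g′ , h ⟩
  row-edge g~g′ = step⇒edge (inj₁ (g~g′ , refl))

  column-edge : ∀ {g h h′} → Adj H h h′ → Adj (G □ H) ⟨ g , h ⟩ ⟨ g , h′ ⟩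
  column-edge h~h′ = step⇒edge (inj₂ (refl , h~h′))

  π₁-projection : CycleProjection (G □ H) G
  π₁-projection = record
    { map                 = π₁
    ; edge⇒≡⊎edge         = λ { (inj₁ (g~g′ , _)) → inj₂ g~g′ ; (inj₂ (g≡g′ , _)) → inj₁ g≡g′ }
    ; injective-off-fibre = injective-off-fibre
    }
    where
    injective-off-fibre : ∀ {w u u′} → Adj (G □ H) w u → Adj (G □ H) w u′ → π₁ w ≢ π₁ u → π₁ u ≡ π₁ u′ → u ≡ u′
    injective-off-fibre (inj₂ (w≡u , _)) _                  w≢u _     = contradiction w≡u w≢u
    injective-off-fibre (inj₁ _)         (inj₂ (w≡u′ , _))  w≢u u≡u′ = contradiction (trans w≡u′ (sym u≡u′)) w≢u
    injective-off-fibre (inj₁ (_ , w≡u)) (inj₁ (_ , w≡u′)) _   u≡u′ = π-injective u≡u′ (trans (sym w≡u) w≡u′)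

  π₂-projection : CycleProjection (G □ H) H
  π₂-projection = record
    { map                 = π₂
    ; edge⇒≡⊎edge         = λ { (inj₁ (_ , h≡h′)) → inj₁ h≡h′ ; (inj₂ (_ , h~h′)) → inj₂ h~h′ }
    ; injective-off-fibre = injective-off-fibre
    }
    where
    injective-off-fibre : ∀ {w u u′} → Adj (G □ H) w u → Adj (G □ H) w u′ → π₂ w ≢ π₂ u → π₂ u ≡ π₂ u′ → u ≡ u′
    injective-off-fibre (inj₁ (_ , w≡u)) _                  w≢u _     = contradiction w≡u w≢u
    injective-off-fibre (inj₂ _)         (inj₁ (_ , w≡u′))  w≢u u≡u′ = contradiction (trans w≡u′ (sym u≡u′)) w≢u
    injective-off-fibre (inj₂ (w≡u , _)) (inj₂ (w≡u′ , _)) _   u≡u′ = π-injective (trans (sym w≡u) w≡u′) u≡u′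

  row : Vertex H → CycleProjection G (G □ H)
  row h = embedding ⟨_, h ⟩ (λ {g} {g′} eq → proj₁ (combine-injective g h g′ h eq)) row-edge

  column : Vertex G → CycleProjection H (G □ H)
  column g = embedding ⟨ g ,_⟩ (λ {h} {h′} eq → proj₂ (combine-injective g h g h′ eq)) column-edge

  square-closed : ∀ {T g g′ h h′} → Convex (G □ H) T → Adj G g g′ → Adj H h h′ →
                  ⟨ g , h ⟩ ∈ T → ⟨ g′ , h ⟩ ∈ T → ⟨ g , h′ ⟩ ∈ T → ⟨ g′ , h′ ⟩ ∈ T
  square-closed {g = g} convex g~g′ h~h′ gh∈T g′h∈T gh′∈T = convex⇒detour-closed {G □ H} convex λ _ → record
    { walk       = row-edge (adj-sym G g~g′) ◅ column-edge h~h′ ◅ ε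
    ; first≢last = λ g′h≡gh′ → adj-irrefl G (subst (Adj G g) (proj₁ (combine-injective _ _ _ _ g′h≡gh′)) g~g′)
    ; inside-S   = g′h∈T ∷ gh∈T ∷ gh′∈T ∷ []
    ; enter      = column-edge (adj-sym H h~h′)
    ; leave      = row-edge g~g′
    }

  convex-⊇-cross⇒⊤ : ∀ {T g₀ h₀} → Connected G → Connected H → Convex (G □ H) T →
                     (∀ g → ⟨ g , h₀ ⟩ ∈ T) → (∀ h → ⟨ g₀ , h ⟩ ∈ T) → ∀ g h → ⟨ g , h ⟩ ∈ T
  convex-⊇-cross⇒⊤ {T} {g₀} {h₀} connected-G connected-H convex row⊆T column⊆T g =
    propagate (λ g → ∀ h → ⟨ g , h ⟩ ∈ T) next-column (connected-G g₀ g) column⊆T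
    where
    next-column : ∀ {g g′} → Adj G g g′ → (∀ h → ⟨ g , h ⟩ ∈ T) → ∀ h → ⟨ g′ , h ⟩ ∈ T
    next-column {g} {g′} g~g′ column-g⊆T h =
      propagate (λ h → ⟨ g′ , h ⟩ ∈ T)
        (λ h~h′ g′h∈T → square-closed convex g~g′ h~h′ (column-g⊆T _) g′h∈T (column-g⊆T _))
        (connected-H h₀ h) (row⊆T g′)

  -- ⟨ g₀ , h₀ ⟩ already lies on the row, which is why h₀ may be dropped from SH.
  □-hullSet : ∀ {SG SH} → Connected G → Connected H → IsHullSet G SG → IsHullSet H SH →
              ∀ g₀ h₀ → IsHullSet (G □ H) (image ⟨_, h₀ ⟩ SG ∪ image ⟨ g₀ ,_⟩ (SH - h₀))
  □-hullSet {SG} {SH} connected-G connected-H hull-G hull-H g₀ h₀ v T S⊆T convex =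
    subst (_∈ T) (⟨π₁,π₂⟩ v) (convex-⊇-cross⇒⊤ connected-G connected-H convex row⊆T column⊆T (π₁ v) (π₂ v))
    where
    row⊆T : ∀ g → ⟨ g , h₀ ⟩ ∈ T
    row⊆T = hullSet-maps-into-convex (row h₀) hull-G convex (S⊆T ∘ x∈p∪q⁺ ∘ inj₁ ∘ ∈-image⁺ ⟨_, h₀ ⟩)
    SH→T : ∀ {h} → h ∈ SH → ⟨ g₀ , h ⟩ ∈ T
    SH→T {h} h∈SH with h ≟ h₀
    ... | yes refl = row⊆T g₀
    ... | no  h≢h₀ = S⊆T (x∈p∪q⁺ (inj₂ (∈-image⁺ ⟨ g₀ ,_⟩ (x∈p∧x≢y⇒x∈p-y h∈SH h≢h₀))))
    column⊆T : ∀ h → ⟨ g₀ , h ⟩ ∈ T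
    column⊆T = hullSet-maps-into-convex (column g₀) hull-H convex SH→T

  diagonal-pair-convex : ∀ {x z} → π₁ x ≢ π₁ z → π₂ x ≢ π₂ z → Convex (G □ H) (⁅ x ⁆ ∪ ⁅ z ⁆)
  diagonal-pair-convex {x} {z} π₁x≢π₁z π₂x≢π₂z =
    independent⇒convex {G □ H} λ a∈ b∈ → independent (∈⁅x⁆∪⁅y⁆⁻ x z a∈) (∈⁅x⁆∪⁅y⁆⁻ x z b∈)
    where
    diagonal : ∀ {a b} → π₁ a ≢ π₁ b → π₂ a ≢ π₂ b → ¬ Adj (G □ H) a b
    diagonal _         π₂a≢π₂b (inj₁ (_ , π₂a≡π₂b)) = π₂a≢π₂b π₂a≡π₂b
    diagonal π₁a≢π₁b _         (inj₂ (π₁a≡π₁b , _)) = π₁a≢π₁b π₁a≡π₁b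
    independent : ∀ {a b} → a ≡ x ⊎ a ≡ z → b ≡ x ⊎ b ≡ z → ¬ Adj (G □ H) a b
    independent (inj₁ refl) (inj₁ refl) = adj-irrefl (G □ H)
    independent (inj₁ refl) (inj₂ refl) = diagonal π₁x≢π₁z π₂x≢π₂z
    independent (inj₂ refl) (inj₁ refl) = diagonal (≢-sym π₁x≢π₁z) (≢-sym π₂x≢π₂z)
    independent (inj₂ refl) (inj₂ refl) = adj-irrefl (G □ H)

  -- The corner ⟨ π₁ x , π₂ z ⟩ lies outside the convex set {x, z}, so S has a third element.
  diagonal⇒3≤∣S∣ : ∀ {S x z} → IsHullSet (G □ H) S → x ∈ S → z ∈ S → π₁ x ≢ π₁ z → π₂ x ≢ π₂ z → 3 ≤ ∣ S ∣
  diagonal⇒3≤∣S∣ {S} {x} {z} hull x∈S z∈S π₁x≢π₁z π₂x≢π₂z =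
    third (hullSet-escapes {G □ H} hull (diagonal-pair-convex π₁x≢π₁z π₂x≢π₂z) corner∉pair)
    where
    corner∉pair : ⟨ π₁ x , π₂ z ⟩ ∉ ⁅ x ⁆ ∪ ⁅ z ⁆
    corner∉pair c∈ with ∈⁅x⁆∪⁅y⁆⁻ x z c∈
    ... | inj₁ c≡x = π₂x≢π₂z (trans (cong π₂ (sym c≡x)) (π₂-⟨,⟩ (π₁ x) (π₂ z)))
    ... | inj₂ c≡z = π₁x≢π₁z (trans (sym (π₁-⟨,⟩ (π₁ x) (π₂ z))) (cong π₁ c≡z))
    third : (∃ λ y → y ∈ S × y ∉ ⁅ x ⁆ ∪ ⁅ z ⁆) → 3 ≤ ∣ S ∣
    third (y , y∈S , y∉pair) =
      length≤∣p∣ ((x≢z ∷ x≢y ∷ []) ∷ (z≢y ∷ []) ∷ [] ∷ []) (x∈S ∷ z∈S ∷ y∈S ∷ [])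
      where
      x≢z : x ≢ z
      x≢z = π₁x≢π₁z ∘ cong π₁
      x≢y : x ≢ y
      x≢y refl = y∉pair (x∈p∪q⁺ (inj₁ (x∈⁅x⁆ x)))
      z≢y : z ≢ y
      z≢y refl = y∉pair (x∈p∪q⁺ (inj₂ (x∈⁅x⁆ z)))

  3≤∣hullSet∣ : Nontrivial G → Nontrivial H → ∀ {S} → IsHullSet (G □ H) S → 3 ≤ ∣ S ∣
  3≤∣hullSet∣ nontrivial-G nontrivial-H {S} hull
    with x , x∈S ← hullSet-nonempty {G □ H} hull ⟨ some-element nontrivial-G , some-element nontrivial-H ⟩
    with y  , y∈S  , π₂y≢π₂x  ← hullSet-leaves-fibre π₂-projection ⟨ π₁ x ,_⟩ (π₂-⟨,⟩ (π₁ x)) nontrivial-H hull x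
       | y′ , y′∈S , π₁y′≢π₁x ← hullSet-leaves-fibre π₁-projection ⟨_, π₂ x ⟩ (λ g → π₁-⟨,⟩ g (π₂ x)) nontrivial-G hull x
    with π₁ y ≟ π₁ x | π₂ y′ ≟ π₂ x
  ... | no π₁y≢π₁x | _            = diagonal⇒3≤∣S∣ hull y∈S x∈S π₁y≢π₁x π₂y≢π₂x
  ... | yes _      | no π₂y′≢π₂x = diagonal⇒3≤∣S∣ hull y′∈S x∈S π₁y′≢π₁x π₂y′≢π₂x
  ... | yes π₁y≡π₁x | yes _       =
    length≤∣p∣ ((x≢y ∷ x≢y′ ∷ []) ∷ (y≢y′ ∷ []) ∷ [] ∷ []) (x∈S ∷ y∈S ∷ y′∈S ∷ [])
    where
    x≢y : x ≢ y
    x≢y = π₂y≢π₂x ∘ sym ∘ cong π₂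
    x≢y′ : x ≢ y′
    x≢y′ = π₁y′≢π₁x ∘ sym ∘ cong π₁
    y≢y′ : y ≢ y′
    y≢y′ y≡y′ = π₁y′≢π₁x (trans (cong π₁ (sym y≡y′)) π₁y≡π₁x)

  hullNumber-≤ˡ : Nontrivial H → ∀ {a c} → IsHullNumber G a → IsHullNumber (G □ H) c → a ≤ c
  hullNumber-≤ˡ nontrivial-H = hullNumber-≤ π₁-projection ⟨_, h ⟩ (λ g → π₁-⟨,⟩ g h)
    where
    h : Vertex H
    h = some-element nontrivial-H

  hullNumber-≤ʳ : Nontrivial G → ∀ {b c} → IsHullNumber H b → IsHullNumber (G □ H) c → b ≤ c
  hullNumber-≤ʳ nontrivial-G = hullNumber-≤ π₂-projection ⟨ g ,_⟩ (π₂-⟨,⟩ g)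
    where
    g : Vertex G
    g = some-element nontrivial-G

  3≤hullNumber : Nontrivial G → Nontrivial H → ∀ {c} → IsHullNumber (G □ H) c → 3 ≤ c
  3≤hullNumber nontrivial-G nontrivial-H ((_ , hull , refl) , _) = 3≤∣hullSet∣ nontrivial-G nontrivial-H hull

  hullNumber-≤-sum : Connected G → Connected H → Nontrivial G → Nontrivial H → ∀ {a b c} →
                     IsHullNumber G a → IsHullNumber H b → IsHullNumber (G □ H) c → c ≤ a + b ∸ 1
  hullNumber-≤-sum connected-G connected-H nontrivial-G nontrivial-H {c = c}
                   ((SG , hull-G , refl) , _) ((SH , hull-H , refl) , _) (_ , minimal)
    with h₀ , h₀∈SH ← hullSet-nonempty {H} hull-H (some-element nontrivial-H) = begin
      c                                                   ≤⟨ minimal _ (□-hullSet connected-G connected-H hull-G hull-H g₀ h₀) ⟩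
      ∣ image ⟨_, h₀ ⟩ SG ∪ image ⟨ g₀ ,_⟩ (SH - h₀) ∣     ≤⟨ ∣p∪q∣≤∣p∣+∣q∣ (image ⟨_, h₀ ⟩ SG) _ ⟩
      ∣ image ⟨_, h₀ ⟩ SG ∣ + ∣ image ⟨ g₀ ,_⟩ (SH - h₀) ∣ ≤⟨ +-mono-≤ (∣image∣≤∣p∣ ⟨_, h₀ ⟩ SG) (∣image∣≤∣p∣ ⟨ g₀ ,_⟩ (SH - h₀)) ⟩
      ∣ SG ∣ + ∣ SH - h₀ ∣                                 ≤⟨ +-monoʳ-≤ ∣ SG ∣ (<⇒≤pred SH-h₀<SH) ⟩
      ∣ SG ∣ + pred ∣ SH ∣                                 ≡⟨ +-∸-assoc ∣ SG ∣ (≤-trans (s≤s z≤n) SH-h₀<SH) ⟨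
      ∣ SG ∣ + ∣ SH ∣ ∸ 1                                  ∎
    where
    open ≤-Reasoning
    g₀ : Vertex G
    g₀ = some-element nontrivial-G
    SH-h₀<SH : ∣ SH - h₀ ∣ < ∣ SH ∣
    SH-h₀<SH = x∈p⇒∣p-x∣<∣p∣ h₀∈SH

mainTheorem3 : (G H : Graph) → Nontrivial G → Nontrivial H → Connected G → Connected H →
    (a b c : ℕ) → IsHullNumber G a → IsHullNumber H b → IsHullNumber (G □ H) c →
    (a ⊔ b ⊔ 3 ≤ c) × (c ≤ a + b ∸ 1)
mainTheorem3 G H nontrivial-G nontrivial-H connected-G connected-H a b c hn-G hn-H hn-□ =
  ⊔-lub (⊔-lub (hullNumber-≤ˡ nontrivial-H hn-G hn-□) (hullNumber-≤ʳ nontrivial-G hn-H hn-□))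
        (3≤hullNumber nontrivial-G nontrivial-H hn-□) ,
  hullNumber-≤-sum connected-G connected-H nontrivial-G nontrivial-H hn-G hn-H hn-□
  where open Product G H
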